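{- For each positive integer $n$, let $P_n=(n, n-1, \ldots, 2, 1)$. Then every bipartite graph that realizes the pair $(P_n,P_n)$ is a mirror bipartite graph; that is, the set of bipartite graphs (up to isomorphism) realizing $(P_n,P_n)$ coincides with the set of mirror bipartite graphs (up to isomorphism) realizing $(P_n,P_n)$.
   Context: A bipartite graph is written $G=(V_1\cup V_2,E)$ with stable sets (parts) $V_1,V_2$. A simple bipartite graph $G=(V_1\cup V_2,E)$ realizes a pair $(P,Q)$ of sequences of nonnegative integers if the multiset of degrees of the vertices in $V_1$ equals the multiset of entries of $P$ and the multiset of degrees of the vertices in $V_2$ equals the multiset of entries of $Q$. A mirror bipartite graph is a bipartite graph $G=(V_1\cup V_2,E)$ for which there is a bijection $\varphi:V_1\to V_2$ such that for all $u,v\in V_1$, $u\varphi(v)\in E$ if and only if $\varphi(u)v\in E$. -}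

module Defs where

open import Data.Nat using (ℕ; zero; suc; _+_)
open import Data.Bool using (Bool; true; false)
open import Data.Fin using (Fin)
open import Data.List using (List; []; _∷_; map; allFin; downFrom)
open import Data.Nat.ListAction using (sum)
open import Data.List.Relation.Binary.Permutation.Propositional using (_↭_)
open import Data.Product using (Σ; _×_)
open import Function.Bundles using (_⤖_; Bijection)
open import Relation.Binary.PropositionalEquality using (_≡_)

-- A finite simple bipartite graph with parts V₁ = Fin p and V₂ = Fin q.
-- The edge set is given by its (biadjacency) characteristic function:
-- edge u v = true iff u ∈ V₁ and v ∈ V₂ are adjacent.
record BipartiteGraph (p q : ℕ) : Set where
  field
    edge : Fin p → Fin q → Bool
open BipartiteGraph public

b2n : Bool → ℕ
b2n true  = 1
b2n false = 0

deg₁ : ∀ {p q} → BipartiteGraph p q → Fin p → ℕ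
deg₁ {q = q} G u = sum (map (λ v → b2n (edge G u v)) (allFin q))

deg₂ : ∀ {p q} → BipartiteGraph p q → Fin q → ℕ
deg₂ {p = p} G v = sum (map (λ u → b2n (edge G u v)) (allFin p))

degs₁ : ∀ {p q} → BipartiteGraph p q → List ℕ
degs₁ {p = p} G = map (deg₁ G) (allFin p)

degs₂ : ∀ {p q} → BipartiteGraph p q → List ℕ
degs₂ {q = q} G = map (deg₂ G) (allFin q)

-- G realizes (P , Q): equality of multisets = being permutations of each other
Realizes : ∀ {p q} → BipartiteGraph p q → List ℕ → List ℕ → Set
Realizes G P Q = (degs₁ G ↭ P) × (degs₂ G ↭ Q)

IsMirror : ∀ {p q} → BipartiteGraph p q → Set
IsMirror {p} {q} G =
  Σ (Fin p ⤖ Fin q) λ φ →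
    ∀ (u v : Fin p) →
      edge G u (Bijection.to φ v) ≡ edge G v (Bijection.to φ u)

P : ℕ → List ℕ
P n = map suc (downFrom n)

-- With m = n + 1 both degree lists are permutations of 1, …, m, so the degrees on
-- each side are distinct.  Let c be the threshold graph joining u and v exactly when
-- deg u + deg v > m.  Its row and column sums are again the degrees, so the edge
-- indicator e and c have the same margins, hence the same total weight under every
-- weight of the form α u + β v.  Applied to the weight 2(deg u + deg v) − (2m + 1),
-- which is never zero and is positive exactly where c = 1, this forces e = c.
-- The threshold graph is symmetric in the degrees, so matching each vertex of V₁ with
-- the vertex of V₂ of the same degree exhibits G as a mirror graph.
module Submission where

open import Defs
import Algebra.Properties.Semiring.Sum as SemiringSum
open import Data.Bool using (Bool; true; false; T)
open import Data.Bool.Properties using (T-≡)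
open import Data.Empty using (⊥-elim)
open import Data.Fin using (Fin; zero; suc)
open import Data.List using (List; _∷_; map; allFin; tabulate)
open import Data.List.Properties using (map-tabulate; map-∘; map-cong)
open import Data.List.Membership.Propositional using (_∈_)
open import Data.List.Relation.Unary.Any using (here; there)
open import Data.List.Membership.Propositional.Properties
  using (∈-map⁺; ∈-map⁻; ∈-allFin; ∈-downFrom⁻)
open import Data.List.Relation.Binary.Permutation.Propositional using (_↭_; ↭-sym; ↭-trans; ↭⇒↭ₛ)
open import Data.List.Relation.Binary.Permutation.Propositional.Properties using (∈-resp-↭; map⁺)
open import Data.List.Relation.Binary.Permutation.Setoid.Properties using (Unique-resp-↭)
open import Data.List.Relation.Unary.All using (lookup)
open import Data.List.Relation.Unary.All.Properties using () renaming (map⁻ to All-map⁻)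
open import Data.List.Relation.Unary.AllPairs using (_∷_)
open import Data.List.Relation.Unary.Unique.Propositional using (Unique)
open import Data.List.Relation.Unary.Unique.Propositional.Properties
  using (downFrom⁺) renaming (map⁺ to Unique-map⁺)
open import Data.Nat using (ℕ; zero; suc; _+_; _*_; _∸_; _≤_; _<_; _<ᵇ_; z≤n; s≤s; _≤?_)
open import Data.Nat.ListAction using (sum)
open import Data.Nat.ListAction.Properties using (sum-↭)
open import Data.Nat.Properties
open import Data.Product using (Σ; _×_; _,_; proj₁; proj₂)
open import Function using (_∘_; Injective; Equivalence)
open import Function.Bundles using (_⤖_; mk⤖; Bijection)
open import Relation.Binary.PropositionalEquality
  using (_≡_; refl; sym; trans; cong; cong₂; subst; subst₂; setoid; module ≡-Reasoning)
open import Relation.Nullary using (¬_; yes; no)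

open SemiringSum +-*-semiring
  using (sum-syntax; sum-cong-≗; ∑-distrib-+; ∑-comm; *-distribʳ-sum) renaming (sum to ∑)

sum-tabulate : ∀ {n} (f : Fin n → ℕ) → sum (tabulate f) ≡ ∑[ i < n ] f i
sum-tabulate {zero}  f = refl
sum-tabulate {suc n} f = cong (f zero +_) (sum-tabulate (f ∘ suc))

sum-map-allFin : ∀ {n} (f : Fin n → ℕ) → sum (map f (allFin n)) ≡ ∑[ i < n ] f i
sum-map-allFin f = trans (cong sum (map-tabulate (λ i → i) f)) (sum-tabulate f)

∑-resp-↭ : ∀ {n} {f : Fin n → ℕ} {xs : List ℕ} → map f (allFin n) ↭ xs →
  (h : ℕ → ℕ) → ∑[ i < n ] h (f i) ≡ sum (map h xs)
∑-resp-↭ {n} {f} {xs} f↭xs h = begin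
  ∑[ i < n ] h (f i)               ≡⟨ sum-map-allFin (h ∘ f) ⟨
  sum (map (h ∘ f) (allFin n))     ≡⟨ cong sum (map-∘ (allFin n)) ⟩
  sum (map h (map f (allFin n)))   ≡⟨ sum-↭ (map⁺ h f↭xs) ⟩
  sum (map h xs)                   ∎
  where open ≡-Reasoning

∑-mono-≤ : ∀ {n} {f g : Fin n → ℕ} → (∀ i → f i ≤ g i) → ∑[ i < n ] f i ≤ ∑[ i < n ] g i
∑-mono-≤ {zero}  f≤g = z≤n
∑-mono-≤ {suc n} f≤g = +-mono-≤ (f≤g zero) (∑-mono-≤ (f≤g ∘ suc))

+-≤-tight : ∀ {a b c d} → a ≤ b → c ≤ d → a + c ≡ b + d → a ≡ b × c ≡ d
+-≤-tight {a} {b} {c} {d} a≤b c≤d eq = a≡b , +-cancelˡ-≡ b c d (trans (cong (_+ c) (sym a≡b)) eq)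
  where
  a≡b : a ≡ b
  a≡b = ≤-antisym a≤b (+-cancelʳ-≤ c b a (≤-trans (+-monoʳ-≤ b c≤d) (≤-reflexive (sym eq))))

∑-≤-tight : ∀ {n} {f g : Fin n → ℕ} → (∀ i → f i ≤ g i) →
  ∑[ i < n ] f i ≡ ∑[ i < n ] g i → ∀ i → f i ≡ g i
∑-≤-tight f≤g eq zero    = proj₁ (+-≤-tight (f≤g zero) (∑-mono-≤ (f≤g ∘ suc)) eq)
∑-≤-tight f≤g eq (suc i) =
  ∑-≤-tight (f≤g ∘ suc) (proj₂ (+-≤-tight (f≤g zero) (∑-mono-≤ (f≤g ∘ suc)) eq)) i

module _ {m n : ℕ} where

  ∑∑-distrib-+ : (f g : Fin m → Fin n → ℕ) →
    ∑[ i < m ] ∑[ j < n ] (f i j + g i j) ≡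
    ∑[ i < m ] ∑[ j < n ] f i j + ∑[ i < m ] ∑[ j < n ] g i j
  ∑∑-distrib-+ f g = trans (sum-cong-≗ (λ i → ∑-distrib-+ (f i) (g i)))
    (∑-distrib-+ (λ i → ∑[ j < n ] f i j) (λ i → ∑[ j < n ] g i j))

  ∑∑-≤-tight : {f g : Fin m → Fin n → ℕ} → (∀ i j → f i j ≤ g i j) →
    ∑[ i < m ] ∑[ j < n ] f i j ≡ ∑[ i < m ] ∑[ j < n ] g i j → ∀ i j → f i j ≡ g i j
  ∑∑-≤-tight f≤g eq i = ∑-≤-tight (f≤g i) (∑-≤-tight (λ i → ∑-mono-≤ (f≤g i)) eq i)

  ∑∑-*-+-split : (f : Fin m → Fin n → ℕ) (α : Fin m → ℕ) (β : Fin n → ℕ) →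
    ∑[ i < m ] ∑[ j < n ] (f i j * (α i + β j)) ≡
    ∑[ i < m ] (∑[ j < n ] f i j * α i) + ∑[ j < n ] (∑[ i < m ] f i j * β j)
  ∑∑-*-+-split f α β = begin
    ∑[ i < m ] ∑[ j < n ] (f i j * (α i + β j))
      ≡⟨ sum-cong-≗ (λ i → sum-cong-≗ (λ j → *-distribˡ-+ (f i j) (α i) (β j))) ⟩
    ∑[ i < m ] ∑[ j < n ] (f i j * α i + f i j * β j)
      ≡⟨ ∑∑-distrib-+ (λ i j → f i j * α i) (λ i j → f i j * β j) ⟩
    ∑[ i < m ] ∑[ j < n ] (f i j * α i) + ∑[ i < m ] ∑[ j < n ] (f i j * β j)
      ≡⟨ cong₂ _+_ (sym (sum-cong-≗ (λ i → *-distribʳ-sum (α i) (f i))))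
                   (∑-comm (λ i j → f i j * β j)) ⟩
    ∑[ i < m ] (∑[ j < n ] f i j * α i) + ∑[ j < n ] ∑[ i < m ] (f i j * β j)
      ≡⟨ cong (_ +_) (sum-cong-≗ (λ j → *-distribʳ-sum (β j) (λ i → f i j))) ⟨
    ∑[ i < m ] (∑[ j < n ] f i j * α i) + ∑[ j < n ] (∑[ i < m ] f i j * β j)
      ∎
    where open ≡-Reasoning

  ∑∑-*-+-resp-margins : {f g : Fin m → Fin n → ℕ} →
    (∀ i → ∑[ j < n ] f i j ≡ ∑[ j < n ] g i j) →
    (∀ j → ∑[ i < m ] f i j ≡ ∑[ i < m ] g i j) →
    (α : Fin m → ℕ) (β : Fin n → ℕ) →
    ∑[ i < m ] ∑[ j < n ] (f i j * (α i + β j)) ≡ ∑[ i < m ] ∑[ j < n ] (g i j * (α i + β j))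
  ∑∑-*-+-resp-margins {f} {g} rows cols α β = begin
    ∑[ i < m ] ∑[ j < n ] (f i j * (α i + β j))
      ≡⟨ ∑∑-*-+-split f α β ⟩
    ∑[ i < m ] (∑[ j < n ] f i j * α i) + ∑[ j < n ] (∑[ i < m ] f i j * β j)
      ≡⟨ cong₂ _+_ (sum-cong-≗ (λ i → cong (_* α i) (rows i)))
                   (sum-cong-≗ (λ j → cong (_* β j) (cols j))) ⟩
    ∑[ i < m ] (∑[ j < n ] g i j * α i) + ∑[ j < n ] (∑[ i < m ] g i j * β j)
      ≡⟨ ∑∑-*-+-split g α β ⟨
    ∑[ i < m ] ∑[ j < n ] (g i j * (α i + β j))
      ∎
    where open ≡-Reasoning

<ᵇ-true : ∀ {m n} → m < n → (m <ᵇ n) ≡ true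
<ᵇ-true = Equivalence.to T-≡ ∘ <⇒<ᵇ

<ᵇ-false : ∀ {m n} → n ≤ m → (m <ᵇ n) ≡ false
<ᵇ-false {m} {n} n≤m with m <ᵇ n in eq
... | false = refl
... | true  = ⊥-elim (≤⇒≯ n≤m (<ᵇ⇒< m n (subst T (sym eq) _)))

+-cancelˡ-<ᵇ : ∀ d s x → (d + s <ᵇ d + x) ≡ (s <ᵇ x)
+-cancelˡ-<ᵇ zero    s x = refl
+-cancelˡ-<ᵇ (suc d) s x = +-cancelˡ-<ᵇ d s x

∈P⇒≤ : ∀ {k x} → x ∈ P k → x ≤ k
∈P⇒≤ x∈P with _ , i∈ , refl ← ∈-map⁻ suc x∈P = ∈-downFrom⁻ i∈

Unique-P : ∀ k → Unique (P k)
Unique-P k = Unique-map⁺ suc-injective (downFrom⁺ k)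

count-P-above : ∀ t k → sum (map (λ x → b2n (t <ᵇ x)) (P k)) ≡ k ∸ t
count-P-above t zero = sym (0∸n≡0 t)
count-P-above t (suc k) with t ≤? k
... | yes t≤k rewrite <ᵇ-true (s≤s t≤k) =
  trans (cong suc (count-P-above t k)) (sym (+-∸-assoc 1 t≤k))
... | no t≰k rewrite <ᵇ-false (≰⇒> t≰k) =
  trans (count-P-above t k) (trans (m≤n⇒m∸n≡0 (<⇒≤ k<t)) (sym (m≤n⇒m∸n≡0 k<t)))
  where
  k<t : k < t
  k<t = ≰⇒> t≰k

count-P-complement : ∀ {d m} → d ≤ m → sum (map (λ x → b2n (m <ᵇ d + x)) (P m)) ≡ d
count-P-complement {d} {m} d≤m = begin
  sum (map (λ x → b2n (m <ᵇ d + x)) (P m))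
    ≡⟨ cong (λ m′ → sum (map (λ x → b2n (m′ <ᵇ d + x)) (P m))) (m+[n∸m]≡n d≤m) ⟨
  sum (map (λ x → b2n (d + (m ∸ d) <ᵇ d + x)) (P m))
    ≡⟨ cong sum (map-cong (λ x → cong b2n (+-cancelˡ-<ᵇ d (m ∸ d) x)) (P m)) ⟩
  sum (map (λ x → b2n (m ∸ d <ᵇ x)) (P m))
    ≡⟨ count-P-above (m ∸ d) m ⟩
  m ∸ (m ∸ d)
    ≡⟨ m∸[m∸n]≡n d≤m ⟩
  d ∎
  where open ≡-Reasoning

Separates : Bool → ℕ → ℕ → Set
Separates t x y = (T t → y < x) × (¬ T t → x < y)

separates-half : ∀ m a → Separates (m <ᵇ a) (a * 2) (suc (m * 2))
separates-half m a =
  (λ t → *-monoˡ-≤ 2 (<ᵇ⇒< m a t)) ,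
  (λ ¬t → s≤s (*-monoˡ-≤ 2 (≮⇒≥ {m} {a} (¬t ∘ <⇒<ᵇ))))

module _ {x y : ℕ} where

  private
    1*x+0*y≡x : 1 * x + 0 * y ≡ x
    1*x+0*y≡x = trans (+-identityʳ (1 * x)) (*-identityˡ x)

  -- (b − t)(x − y) ≤ 0, with both sides moved so that no subtraction occurs.
  gain-≤ : ∀ {t} → Separates t x y → ∀ b →
    b2n b * x + b2n t * y ≤ b2n t * x + b2n b * y
  gain-≤ {true}  _            true  = ≤-refl
  gain-≤ {false} _            false = ≤-refl
  gain-≤ {true}  (t⇒y<x , _)  false =
    subst₂ _≤_ (sym (*-identityˡ y)) (sym 1*x+0*y≡x) (<⇒≤ (t⇒y<x _))
  gain-≤ {false} (_ , ¬t⇒x<y) true  =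
    subst₂ _≤_ (sym 1*x+0*y≡x) (sym (*-identityˡ y)) (<⇒≤ (¬t⇒x<y λ ()))

  gain-tight : ∀ {t} → Separates t x y → ∀ b →
    b2n b * x + b2n t * y ≡ b2n t * x + b2n b * y → b ≡ t
  gain-tight {true}  _            true  _  = refl
  gain-tight {false} _            false _  = refl
  gain-tight {true}  (t⇒y<x , _)  false eq =
    ⊥-elim (<-irrefl (trans (sym (*-identityˡ y)) (trans eq 1*x+0*y≡x)) (t⇒y<x _))
  gain-tight {false} (_ , ¬t⇒x<y) true  eq =
    ⊥-elim (<-irrefl (trans (sym 1*x+0*y≡x) (trans eq (*-identityˡ y))) (¬t⇒x<y λ ()))

Unique-map⇒injective : ∀ {A : Set} (f : A → ℕ) {xs : List A} → Unique (map f xs) →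
  ∀ {x y} → x ∈ xs → y ∈ xs → f x ≡ f y → x ≡ y
Unique-map⇒injective f {_ ∷ _} _ (here refl) (here refl) _ = refl
Unique-map⇒injective f {_ ∷ _} (fx∉ ∷ _) (here refl) (there y∈) fx≡fy =
  ⊥-elim (lookup (All-map⁻ fx∉) y∈ fx≡fy)
Unique-map⇒injective f {_ ∷ _} (fy∉ ∷ _) (there x∈) (here refl) fx≡fy =
  ⊥-elim (lookup (All-map⁻ fy∉) x∈ (sym fx≡fy))
Unique-map⇒injective f {_ ∷ _} (_ ∷ unique) (there x∈) (there y∈) fx≡fy =
  Unique-map⇒injective f unique x∈ y∈ fx≡fy

Unique-map-allFin⇒injective : ∀ {n} (f : Fin n → ℕ) → Unique (map f (allFin n)) → Injective _≡_ _≡_ f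
Unique-map-allFin⇒injective f unique = Unique-map⇒injective f unique (∈-allFin _) (∈-allFin _)

↭-labelling⇒⤖ : ∀ {p q} {f : Fin p → ℕ} {g : Fin q → ℕ} →
  map f (allFin p) ↭ map g (allFin q) → Unique (map f (allFin p)) →
  Σ (Fin p ⤖ Fin q) λ φ → ∀ u → g (Bijection.to φ u) ≡ f u
↭-labelling⇒⤖ {p} {q} {f} {g} f↭g f-unique = mk⤖ (φ-injective , φ-surjective) , φ-labelled
  where
  g-injective : Injective _≡_ _≡_ g
  g-injective = Unique-map-allFin⇒injective g (Unique-resp-↭ (setoid ℕ) (↭⇒↭ₛ f↭g) f-unique)

  partner : ∀ u → Σ (Fin q) λ v → v ∈ allFin q × f u ≡ g v
  partner u = ∈-map⁻ g (∈-resp-↭ f↭g (∈-map⁺ f (∈-allFin u)))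

  φ : Fin p → Fin q
  φ u = proj₁ (partner u)

  φ-labelled : ∀ u → g (φ u) ≡ f u
  φ-labelled u = sym (proj₂ (proj₂ (partner u)))

  φ-injective : Injective _≡_ _≡_ φ
  φ-injective {u} {u′} φu≡φu′ = Unique-map-allFin⇒injective f f-unique
    (trans (sym (φ-labelled u)) (trans (cong g φu≡φu′) (φ-labelled u′)))

  φ-surjective : ∀ v → Σ (Fin p) λ u → ∀ {u′} → u′ ≡ u → φ u′ ≡ v
  φ-surjective v with u , _ , gv≡fu ← ∈-map⁻ f (∈-resp-↭ (↭-sym f↭g) (∈-map⁺ g (∈-allFin v))) =
    u , λ { refl → g-injective (trans (φ-labelled u) (sym gv≡fu)) }

module Realization {m p q : ℕ} (G : BipartiteGraph p q)
  (degs₁↭P : degs₁ G ↭ P m) (degs₂↭P : degs₂ G ↭ P m) where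

  threshold : Fin p → Fin q → Bool
  threshold u v = m <ᵇ deg₁ G u + deg₂ G v

  private
    e c : Fin p → Fin q → ℕ
    e u v = b2n (edge G u v)
    c u v = b2n (threshold u v)

    weight : Fin p → Fin q → ℕ
    weight u v = deg₁ G u * 2 + deg₂ G v * 2

    K : ℕ
    K = suc (m * 2)

  deg₁∈P : ∀ u → deg₁ G u ∈ P m
  deg₁∈P u = ∈-resp-↭ degs₁↭P (∈-map⁺ (deg₁ G) (∈-allFin u))

  deg₂∈P : ∀ v → deg₂ G v ∈ P m
  deg₂∈P v = ∈-resp-↭ degs₂↭P (∈-map⁺ (deg₂ G) (∈-allFin v))

  rows-threshold : ∀ u → ∑[ v < q ] c u v ≡ ∑[ v < q ] e u v
  rows-threshold u = begin
    ∑[ v < q ] c u v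
      ≡⟨ ∑-resp-↭ degs₂↭P (λ x → b2n (m <ᵇ deg₁ G u + x)) ⟩
    sum (map (λ x → b2n (m <ᵇ deg₁ G u + x)) (P m))
      ≡⟨ count-P-complement (∈P⇒≤ (deg₁∈P u)) ⟩
    deg₁ G u
      ≡⟨ sum-map-allFin (e u) ⟩
    ∑[ v < q ] e u v
      ∎
    where open ≡-Reasoning

  cols-threshold : ∀ v → ∑[ u < p ] c u v ≡ ∑[ u < p ] e u v
  cols-threshold v = begin
    ∑[ u < p ] c u v
      ≡⟨ sum-cong-≗ (λ u → cong (λ a → b2n (m <ᵇ a)) (+-comm (deg₁ G u) (deg₂ G v))) ⟩
    ∑[ u < p ] b2n (m <ᵇ deg₂ G v + deg₁ G u)
      ≡⟨ ∑-resp-↭ degs₁↭P (λ x → b2n (m <ᵇ deg₂ G v + x)) ⟩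
    sum (map (λ x → b2n (m <ᵇ deg₂ G v + x)) (P m))
      ≡⟨ count-P-complement (∈P⇒≤ (deg₂∈P v)) ⟩
    deg₂ G v
      ≡⟨ sum-map-allFin (λ u → e u v) ⟩
    ∑[ u < p ] e u v
      ∎
    where open ≡-Reasoning

  separation : ∀ u v → Separates (threshold u v) (weight u v) K
  separation u v = subst (λ x → Separates (threshold u v) x K)
    (*-distribʳ-+ 2 (deg₁ G u) (deg₂ G v)) (separates-half m (deg₁ G u + deg₂ G v))

  balance : ∑[ u < p ] ∑[ v < q ] (e u v * weight u v + c u v * K) ≡
            ∑[ u < p ] ∑[ v < q ] (c u v * weight u v + e u v * K)
  balance = begin
    ∑[ u < p ] ∑[ v < q ] (e u v * weight u v + c u v * K)
      ≡⟨ ∑∑-distrib-+ (λ u v → e u v * weight u v) (λ u v → c u v * K) ⟩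
    ∑[ u < p ] ∑[ v < q ] (e u v * weight u v) + ∑[ u < p ] ∑[ v < q ] (c u v * K)
      -- The constant weight K is written 0 + K, which is K definitionally.
      ≡⟨ cong₂ _+_
           (∑∑-*-+-resp-margins (sym ∘ rows-threshold) (sym ∘ cols-threshold)
              (λ u → deg₁ G u * 2) (λ v → deg₂ G v * 2))
           (∑∑-*-+-resp-margins rows-threshold cols-threshold (λ _ → 0) (λ _ → K)) ⟩
    ∑[ u < p ] ∑[ v < q ] (c u v * weight u v) + ∑[ u < p ] ∑[ v < q ] (e u v * K)
      ≡⟨ ∑∑-distrib-+ (λ u v → c u v * weight u v) (λ u v → e u v * K) ⟨
    ∑[ u < p ] ∑[ v < q ] (c u v * weight u v + e u v * K)
      ∎
    where open ≡-Reasoning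

  edge≡threshold : ∀ u v → edge G u v ≡ threshold u v
  edge≡threshold u v = gain-tight (separation u v) (edge G u v)
    (∑∑-≤-tight (λ u v → gain-≤ (separation u v) (edge G u v)) balance u v)

  isMirror : IsMirror G
  isMirror = φ , mirror
    where
    degree-matching : Σ (Fin p ⤖ Fin q) λ φ → ∀ u → deg₂ G (Bijection.to φ u) ≡ deg₁ G u
    degree-matching = ↭-labelling⇒⤖ (↭-trans degs₁↭P (↭-sym degs₂↭P))
      (Unique-resp-↭ (setoid ℕ) (↭⇒↭ₛ (↭-sym degs₁↭P)) (Unique-P m))

    φ : Fin p ⤖ Fin q
    φ = proj₁ degree-matching
    open Bijection φ using (to)

    mirror : ∀ u v → edge G u (to v) ≡ edge G v (to u)
    mirror u v = begin
      edge G u (to v)                    ≡⟨ edge≡threshold u (to v) ⟩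
      m <ᵇ deg₁ G u + deg₂ G (to v)      ≡⟨ cong (λ d → m <ᵇ deg₁ G u + d) (proj₂ degree-matching v) ⟩
      m <ᵇ deg₁ G u + deg₁ G v           ≡⟨ cong (m <ᵇ_) (+-comm (deg₁ G u) (deg₁ G v)) ⟩
      m <ᵇ deg₁ G v + deg₁ G u           ≡⟨ cong (λ d → m <ᵇ deg₁ G v + d) (proj₂ degree-matching u) ⟨
      m <ᵇ deg₁ G v + deg₂ G (to u)      ≡⟨ edge≡threshold v (to u) ⟨
      edge G v (to u)                    ∎
      where open ≡-Reasoning

mainTheorem4 : (n p q : ℕ) (G : BipartiteGraph p q) →
    Realizes G (P (suc n)) (P (suc n)) → IsMirror G
mainTheorem4 n p q G (degs₁↭P , degs₂↭P) = Realization.isMirror G degs₁↭P degs₂↭P
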